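{- Let $\alpha\in(0,1)$ be irrational, $\alpha=[0;a_1,a_2,\dots]$, and let $n\ge1$ with $a_n\ge2$ and $a_{n+1}\ge2$. Then $q_n-q_{n-1}$ and $q_n+q_{n-1}$ are two successive elements of the sequence $\mathfrak{Q}$.
   Context: $p_n/q_n=[0;a_1,\dots,a_n]$ ($n\ge0$, lowest terms, $q_n>0$) are the convergents of $\alpha$, with $q_{ -1}=0$, $q_0=1$, $q_n=a_nq_{n-1}+q_{n-2}$. For $t\ge1$, $\psi^{[2]}_\alpha(t)=\min\{|q\alpha-p|: p,q\in\mathbb{Z},\ 1\le q\le t,\ (p,q)\ne(p_n,q_n)\ \forall n\ge0\}$; this function is piecewise constant with integer points of discontinuity. $\mathfrak{Q}:\ 1=\mathfrak{q}_1<\mathfrak{q}_2<\dots$ is the increasing sequence consisting of $1$ and all points of discontinuity of $\psi^{[2]}_\alpha$. -}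

module Defs where

open import Data.Nat using (ℕ; zero; suc; _+_; _*_; _∸_; _≤_; _<_)
open import Data.Integer as ℤ using (ℤ; +_; ∣_∣)
open import Data.Product using (Σ; _×_; _,_; proj₁; proj₂)
open import Data.Sum using (_⊎_)
open import Relation.Binary.PropositionalEquality using (_≡_)
open import Relation.Nullary using (¬_)

-- An irrational α ∈ (0,1) is encoded by its (infinite) continued fraction
-- α = [0; a 1, a 2, ...] ; the value  a 0  is ignored (a_0 = 0).
PartialQuotients : (ℕ → ℕ) → Set
PartialQuotients a = ∀ i → 1 ≤ i → 1 ≤ a i

-- (q_{n-1} , q_n), with q_{-1} = 0, q_0 = 1, q_n = a_n q_{n-1} + q_{n-2}
qPair : (ℕ → ℕ) → ℕ → ℕ × ℕ
qPair a zero = 0 , 1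
qPair a (suc n) = proj₂ (qPair a n) , a (suc n) * proj₂ (qPair a n) + proj₁ (qPair a n)

-- (p_{n-1} , p_n), with p_{-1} = 1, p_0 = 0 (= a_0), p_n = a_n p_{n-1} + p_{n-2}
pPair : (ℕ → ℕ) → ℕ → ℕ × ℕ
pPair a zero = 1 , 0
pPair a (suc n) = proj₂ (pPair a n) , a (suc n) * proj₂ (pPair a n) + proj₁ (pPair a n)

qc : (ℕ → ℕ) → ℕ → ℕ
qc a n = proj₂ (qPair a n)

pc : (ℕ → ℕ) → ℕ → ℕ
pc a n = proj₂ (pPair a n)

-- q_{n-1}  (so qPrev a 0 = q_{-1} = 0)
qPrev : (ℕ → ℕ) → ℕ → ℕ
qPrev a n = proj₁ (qPair a n)

IsConvergent : (ℕ → ℕ) → ℤ → ℕ → Set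
IsConvergent a p q = Σ ℕ λ n → (p ≡ + pc a n) × (q ≡ qc a n)

-- | q·(P/Q) − p | · Q = | q P − p Q |  for the rational P/Q
scaledDist : ℤ → ℕ → ℕ → ℕ → ℕ
scaledDist p q P Q = ∣ (+ q ℤ.* + P) ℤ.- (p ℤ.* + Q) ∣

-- |qα − p| < |q'α − p'| , with α the limit of its convergents p_k/q_k:
-- eventually in k, |q p_k/q_k − p| < |q' p_k/q_k − p'|
-- (both sides multiplied by q_k > 0).  For irrational α this is equivalent
-- to the strict inequality of the real numbers.
Closer : (ℕ → ℕ) → ℤ → ℕ → ℤ → ℕ → Set
Closer a p q p' q' =
  Σ ℕ λ K → ∀ k → K ≤ k →
    scaledDist p q (pc a k) (qc a k) < scaledDist p' q' (pc a k) (qc a k)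

-- t is a point of discontinuity of ψ^{[2]}_α (t ≥ 2 integer):
-- ψ^{[2]}_α(t) < ψ^{[2]}_α(t-1), i.e. some non-convergent (p,t) is strictly
-- closer than every non-convergent (p',q') with 1 ≤ q' ≤ t-1.
Discontinuity : (ℕ → ℕ) → ℕ → Set
Discontinuity a t =
  2 ≤ t × Σ ℤ λ p → ¬ IsConvergent a p t ×
    (∀ (p' : ℤ) (q' : ℕ) → 1 ≤ q' → q' < t → ¬ IsConvergent a p' q' →
       Closer a p t p' q')

InQ : (ℕ → ℕ) → ℕ → Set
InQ a t = t ≡ 1 ⊎ Discontinuity a t

Successive : (ℕ → ℕ) → ℕ → ℕ → Set
Successive a s s' =
  InQ a s × InQ a s' × s < s' × (∀ t → InQ a t → s < t → ¬ (t < s'))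

-- For k > n put L_k (p , q) = q p_k - p q_k, so that ∣ L_k ∣ is the scaled distance at α ≈ p_k / q_k.
-- The last two convergents have errors of opposite signs, L_k c_n = - e A and L_k c_{n-1} = e B with
-- e = ±1, and a_{n+1} ≥ 2 gives 1 ≤ A < B.  As det (c_n , c_{n-1}) = ±1, every (p , q) is
-- x c_n + y c_{n-1} with x, y ∈ ℤ, hence ∣ L_k (p , q) ∣ = ∣ x A - y B ∣.  If (p , q) is not a
-- convergent and 1 ≤ q < q_n + q_{n-1}, the equation q = x q_n + y q_{n-1} forces x and y to have
-- opposite signs (or x = 0, y ≥ 2), so ∣ L_k (p , q) ∣ ≥ A + B, with equality only for
-- (x , y) = (1 , -1), i.e. at q_n - q_{n-1}.  The sum (1 , 1) has error B - A < A + B.  So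
-- q_n - q_{n-1} beats every smaller non-convergent denominator, q_n + q_{n-1} beats every smaller
-- one, and no denominator in between beats q_n - q_{n-1}.
module Submission where

open import Defs
open import Data.Nat using (ℕ; suc; _+_; _∸_; _≤_)
open import Data.Nat as ℕ using (zero; _<_; _*_; z≤n; s≤s; _≤′_; _≤‴_)
import Data.Nat.Properties as ℕ
open import Data.Integer as ℤ using (ℤ; +_; -[1+_]; +[1+_]; 0ℤ; 1ℤ; -1ℤ; ∣_∣)
import Data.Integer.Properties as ℤ
open import Data.Integer.Tactic.RingSolver using (solve-∀)
open import Data.Nat.Tactic.RingSolver using () renaming (solve-∀ to ℕ-solve-∀)
open import Data.Product using (_×_; _,_; proj₁; proj₂)
open import Data.Sum using (_⊎_; inj₁; inj₂)
open import Data.Empty using (⊥-elim)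
open import Function using (_∘_)
open import Relation.Nullary using (¬_; yes; no)
open import Relation.Binary.PropositionalEquality
open ≡-Reasoning

ℤ² : Set
ℤ² = ℤ × ℤ

infixl 7 _·_
infix  7 _∧_
infixl 6 _⊕_

-- scaledDist p q P Q is definitionally ∣ (p , + q) ∧ (+ P , + Q) ∣.
_∧_ : ℤ² → ℤ² → ℤ
(p , q) ∧ (p′ , q′) = q ℤ.* p′ ℤ.- p ℤ.* q′

_·_ : ℤ → ℤ² → ℤ²
x · (p , q) = x ℤ.* p , x ℤ.* q

_⊕_ : ℤ² → ℤ² → ℤ²
(p , q) ⊕ (p′ , q′) = p ℤ.+ p′ , q ℤ.+ q′

private variable
  u w z : ℤ²
  e i j l : ℤ
  a : ℕ → ℕ
  m t : ℕ

∧-self : ∀ u → u ∧ u ≡ 0ℤ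
∧-self (p , q) = identity p q
  where identity : ∀ p q → q ℤ.* p ℤ.- p ℤ.* q ≡ 0ℤ
        identity = solve-∀

∧-antisym : ∀ u v → u ∧ v ≡ ℤ.- (v ∧ u)
∧-antisym (p , q) (p′ , q′) = identity p q p′ q′
  where identity : ∀ p q p′ q′ → q ℤ.* p′ ℤ.- p ℤ.* q′ ≡ ℤ.- (q′ ℤ.* p ℤ.- p′ ℤ.* q)
        identity = solve-∀

∧-distribʳ-⊕ : ∀ u w v → (u ⊕ w) ∧ v ≡ u ∧ v ℤ.+ w ∧ v
∧-distribʳ-⊕ (p , q) (p′ , q′) (P , Q) = identity p q p′ q′ P Q
  where identity : ∀ p q p′ q′ P Q → (q ℤ.+ q′) ℤ.* P ℤ.- (p ℤ.+ p′) ℤ.* Q ≡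
                                      (q ℤ.* P ℤ.- p ℤ.* Q) ℤ.+ (q′ ℤ.* P ℤ.- p′ ℤ.* Q)
        identity = solve-∀

∧-·ˡ : ∀ x u v → (x · u) ∧ v ≡ x ℤ.* (u ∧ v)
∧-·ˡ x (p , q) (P , Q) = identity x p q P Q
  where identity : ∀ x p q P Q → x ℤ.* q ℤ.* P ℤ.- x ℤ.* p ℤ.* Q ≡ x ℤ.* (q ℤ.* P ℤ.- p ℤ.* Q)
        identity = solve-∀

∧-combination : ∀ x y u w v → (x · u ⊕ y · w) ∧ v ≡ x ℤ.* (u ∧ v) ℤ.+ y ℤ.* (w ∧ v)
∧-combination x y u w v = begin
  (x · u ⊕ y · w) ∧ v          ≡⟨ ∧-distribʳ-⊕ (x · u) (y · w) v ⟩
  (x · u) ∧ v ℤ.+ (y · w) ∧ v  ≡⟨ cong₂ ℤ._+_ (∧-·ˡ x u v) (∧-·ˡ y w v) ⟩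
  x ℤ.* (u ∧ v) ℤ.+ y ℤ.* (w ∧ v) ∎

∧-cramer : ∀ x u w v → (x ℤ.* (v ∧ w)) · u ⊕ (x ℤ.* (u ∧ v)) · w ≡ (x ℤ.* (u ∧ w)) · v
∧-cramer x (p , q) (p′ , q′) (P , Q) = cong₂ _,_ (identity₁ x p q p′ q′ P Q) (identity₂ x p q p′ q′ P Q)
  where identity₁ : ∀ x p q p′ q′ P Q →
          x ℤ.* (Q ℤ.* p′ ℤ.- P ℤ.* q′) ℤ.* p ℤ.+ x ℤ.* (q ℤ.* P ℤ.- p ℤ.* Q) ℤ.* p′ ≡
          x ℤ.* (q ℤ.* p′ ℤ.- p ℤ.* q′) ℤ.* P
        identity₁ = solve-∀
        identity₂ : ∀ x p q p′ q′ P Q →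
          x ℤ.* (Q ℤ.* p′ ℤ.- P ℤ.* q′) ℤ.* q ℤ.+ x ℤ.* (q ℤ.* P ℤ.- p ℤ.* Q) ℤ.* q′ ≡
          x ℤ.* (q ℤ.* p′ ℤ.- p ℤ.* q′) ℤ.* Q
        identity₂ = solve-∀

1·u≡u : ∀ u → 1ℤ · u ≡ u
1·u≡u (p , q) = cong₂ _,_ (ℤ.*-identityˡ p) (ℤ.*-identityˡ q)

1·u⊕0·w≡u : ∀ u w → 1ℤ · u ⊕ 0ℤ · w ≡ u
1·u⊕0·w≡u (p , q) (p′ , q′) = cong₂ _,_ (identity p p′) (identity q q′)
  where identity : ∀ p p′ → 1ℤ ℤ.* p ℤ.+ 0ℤ ℤ.* p′ ≡ p
        identity = solve-∀

0·u⊕1·w≡w : ∀ u w → 0ℤ · u ⊕ 1ℤ · w ≡ w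
0·u⊕1·w≡w (p , q) (p′ , q′) = cong₂ _,_ (identity p p′) (identity q q′)
  where identity : ∀ p p′ → 0ℤ ℤ.* p ℤ.+ 1ℤ ℤ.* p′ ≡ p′
        identity = solve-∀

IsSign : ℤ → Set
IsSign e = e ≡ 1ℤ ⊎ e ≡ -1ℤ

IsSign-neg : IsSign e → IsSign (ℤ.- e)
IsSign-neg (inj₁ refl) = inj₂ refl
IsSign-neg (inj₂ refl) = inj₁ refl

IsSign⇒e*e≡1 : IsSign e → e ℤ.* e ≡ 1ℤ
IsSign⇒e*e≡1 (inj₁ refl) = refl
IsSign⇒e*e≡1 (inj₂ refl) = refl

IsSign⇒∣e*i∣≡∣i∣ : IsSign e → ∀ i → ∣ e ℤ.* i ∣ ≡ ∣ i ∣
IsSign⇒∣e*i∣≡∣i∣ (inj₁ refl) i = cong ∣_∣ (ℤ.*-identityˡ i)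
IsSign⇒∣e*i∣≡∣i∣ (inj₂ refl) i = trans (cong ∣_∣ (ℤ.-1*i≡-i i)) (ℤ.∣-i∣≡∣i∣ i)

∧-basis : ∀ u w v → IsSign (u ∧ w) →
          ((u ∧ w) ℤ.* (v ∧ w)) · u ⊕ ((u ∧ w) ℤ.* (u ∧ v)) · w ≡ v
∧-basis u w v sign = begin
  ((u ∧ w) ℤ.* (v ∧ w)) · u ⊕ ((u ∧ w) ℤ.* (u ∧ v)) · w  ≡⟨ ∧-cramer (u ∧ w) u w v ⟩
  ((u ∧ w) ℤ.* (u ∧ w)) · v                               ≡⟨ cong (_· v) (IsSign⇒e*e≡1 sign) ⟩
  1ℤ · v                                                   ≡⟨ 1·u≡u v ⟩
  v                                                        ∎

pos-*-+ : ∀ m n k → + (m * n + k) ≡ + m ℤ.* + n ℤ.+ + k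
pos-*-+ m n k = trans (ℤ.pos-+ (m * n) k) (cong (ℤ._+ + k) (ℤ.pos-* m n))

record OppositeSigns (i j : ℤ) : Set where
  field
    sign    : ℤ
    isSign  : IsSign sign
    ∣i∣ ∣j∣ : ℕ
    1≤∣i∣   : 1 ≤ ∣i∣
    i≡      : i ≡ sign ℤ.* + ∣i∣
    j≡      : j ≡ ℤ.- (sign ℤ.* + ∣j∣)

OppositeSigns-step : ∀ m → 1 ≤ m → j ≡ + m ℤ.* i ℤ.+ l → OppositeSigns i j → OppositeSigns l i
OppositeSigns-step {j = j} {i = i} {l = l} m 1≤m j≡mi+l o = record
  { sign   = ℤ.- sign
  ; isSign = IsSign-neg isSign
  ; ∣i∣    = m * ∣i∣ + ∣j∣
  ; ∣j∣    = ∣i∣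
  ; 1≤∣i∣  = ℕ.≤-trans 1≤∣i∣ (ℕ.≤-trans (ℕ.m≤n*m ∣i∣ m {{ℕ.>-nonZero 1≤m}}) (ℕ.m≤m+n _ ∣j∣))
  ; i≡     = l≡
  ; j≡     = trans i≡ (double-negation sign (+ ∣i∣))
  }
  where
  open OppositeSigns o
  subtract : ∀ M i l → l ≡ (M ℤ.* i ℤ.+ l) ℤ.- M ℤ.* i
  subtract = solve-∀
  collect : ∀ e M U V → ℤ.- (e ℤ.* V) ℤ.- M ℤ.* (e ℤ.* U) ≡ (ℤ.- e) ℤ.* (M ℤ.* U ℤ.+ V)
  collect = solve-∀
  double-negation : ∀ e U → e ℤ.* U ≡ ℤ.- ((ℤ.- e) ℤ.* U)
  double-negation = solve-∀
  l≡ : l ≡ (ℤ.- sign) ℤ.* + (m * ∣i∣ + ∣j∣)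
  l≡ = begin
    l                                                  ≡⟨ subtract (+ m) i l ⟩
    (+ m ℤ.* i ℤ.+ l) ℤ.- + m ℤ.* i                    ≡⟨ cong (ℤ._- + m ℤ.* i) j≡mi+l ⟨
    j ℤ.- + m ℤ.* i                                    ≡⟨ cong₂ (λ s t → s ℤ.- + m ℤ.* t) j≡ i≡ ⟩
    ℤ.- (sign ℤ.* + ∣j∣) ℤ.- + m ℤ.* (sign ℤ.* + ∣i∣)  ≡⟨ collect sign (+ m) (+ ∣i∣) (+ ∣j∣) ⟩
    (ℤ.- sign) ℤ.* (+ m ℤ.* + ∣i∣ ℤ.+ + ∣j∣)           ≡⟨ cong ((ℤ.- sign) ℤ.*_) (pos-*-+ m ∣i∣ ∣j∣) ⟨
    (ℤ.- sign) ℤ.* + (m * ∣i∣ + ∣j∣)                   ∎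

∣combination∧∣≡ : (o : OppositeSigns (w ∧ z) (u ∧ z)) → ∀ x y →
                  ∣ (x · u ⊕ y · w) ∧ z ∣ ≡
                  ∣ x ℤ.* + OppositeSigns.∣j∣ o ℤ.- y ℤ.* + OppositeSigns.∣i∣ o ∣
∣combination∧∣≡ {w} {z} {u} o x y = begin
  ∣ (x · u ⊕ y · w) ∧ z ∣                                   ≡⟨ cong ∣_∣ (∧-combination x y u w z) ⟩
  ∣ x ℤ.* (u ∧ z) ℤ.+ y ℤ.* (w ∧ z) ∣                       ≡⟨ cong₂ (λ s t → ∣ x ℤ.* s ℤ.+ y ℤ.* t ∣) j≡ i≡ ⟩
  ∣ x ℤ.* ℤ.- (sign ℤ.* A) ℤ.+ y ℤ.* (sign ℤ.* B) ∣         ≡⟨ cong ∣_∣ (factor sign x y A B) ⟩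
  ∣ (ℤ.- sign) ℤ.* (x ℤ.* A ℤ.- y ℤ.* B) ∣                 ≡⟨ IsSign⇒∣e*i∣≡∣i∣ (IsSign-neg isSign) _ ⟩
  ∣ x ℤ.* A ℤ.- y ℤ.* B ∣                                  ∎
  where
  open OppositeSigns o
  A B : ℤ
  A = + ∣j∣
  B = + ∣i∣
  factor : ∀ e x y A B → x ℤ.* ℤ.- (e ℤ.* A) ℤ.+ y ℤ.* (e ℤ.* B) ≡ (ℤ.- e) ℤ.* (x ℤ.* A ℤ.- y ℤ.* B)
  factor = solve-∀

conv conv⁻ : (ℕ → ℕ) → ℕ → ℤ²
conv  a n = + pc a n , + qc a n
conv⁻ a n = + proj₁ (pPair a n) , + qPrev a n

conv-suc-∧ : ∀ a n v → conv a (suc n) ∧ v ≡ + a (suc n) ℤ.* (conv a n ∧ v) ℤ.+ conv⁻ a n ∧ v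
conv-suc-∧ a n v = begin
  conv a (suc n) ∧ v                          ≡⟨ cong (_∧ v) conv-suc ⟩
  (A · conv a n ⊕ conv⁻ a n) ∧ v              ≡⟨ ∧-distribʳ-⊕ (A · conv a n) (conv⁻ a n) v ⟩
  (A · conv a n) ∧ v ℤ.+ conv⁻ a n ∧ v        ≡⟨ cong (ℤ._+ conv⁻ a n ∧ v) (∧-·ˡ A (conv a n) v) ⟩
  A ℤ.* (conv a n ∧ v) ℤ.+ conv⁻ a n ∧ v      ∎
  where
  A : ℤ
  A = + a (suc n)
  conv-suc : conv a (suc n) ≡ A · conv a n ⊕ conv⁻ a n
  conv-suc = cong₂ _,_ (pos-*-+ (a (suc n)) (pc a n) _) (pos-*-+ (a (suc n)) (qc a n) (qPrev a n))

conv∧conv⁻-isSign : ∀ a n → IsSign (conv a n ∧ conv⁻ a n)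
conv∧conv⁻-isSign a zero    = inj₁ refl
conv∧conv⁻-isSign a (suc n) = subst IsSign (sym alternates) (IsSign-neg (conv∧conv⁻-isSign a n))
  where
  c c⁻ : ℤ²
  c  = conv a n
  c⁻ = conv⁻ a n
  alternates : conv a (suc n) ∧ c ≡ ℤ.- (c ∧ c⁻)
  alternates = begin
    conv a (suc n) ∧ c                  ≡⟨ conv-suc-∧ a n c ⟩
    + a (suc n) ℤ.* (c ∧ c) ℤ.+ c⁻ ∧ c  ≡⟨ cong₂ (λ s t → + a (suc n) ℤ.* s ℤ.+ t)
                                                  (∧-self c) (∧-antisym c⁻ c) ⟩
    + a (suc n) ℤ.* 0ℤ ℤ.+ ℤ.- (c ∧ c⁻) ≡⟨ cong (ℤ._+ ℤ.- (c ∧ c⁻)) (ℤ.*-zeroʳ (+ a (suc n))) ⟩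
    0ℤ ℤ.+ ℤ.- (c ∧ c⁻)                 ≡⟨ ℤ.+-identityˡ _ ⟩
    ℤ.- (c ∧ c⁻)                        ∎

alternating : PartialQuotients a → ∀ {j k} → j ≤‴ k →
              OppositeSigns (conv⁻ a j ∧ conv a k) (conv a j ∧ conv a k)
alternating {a} pa {j} ℕ.≤‴-refl = record
  { sign   = ℤ.- (conv a j ∧ conv⁻ a j)
  ; isSign = IsSign-neg (conv∧conv⁻-isSign a j)
  ; ∣i∣    = 1
  ; ∣j∣    = 0
  ; 1≤∣i∣  = ℕ.≤-refl
  ; i≡     = trans (∧-antisym (conv⁻ a j) (conv a j)) (sym (ℤ.*-identityʳ _))
  ; j≡     = trans (∧-self (conv a j)) (cong ℤ.-_ (sym (ℤ.*-zeroʳ (ℤ.- (conv a j ∧ conv⁻ a j)))))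
  }
alternating {a} pa {j} {k} (ℕ.≤‴-step j<k) =
  OppositeSigns-step (a (suc j)) (pa (suc j) (s≤s z≤n)) (conv-suc-∧ a j (conv a k)) (alternating pa j<k)

qc-suc-≥ : ∀ a t → m ≤ a (suc t) → m * qc a t + qPrev a t ≤ qc a (suc t)
qc-suc-≥ a t m≤a = ℕ.+-monoˡ-≤ (qPrev a t) (ℕ.*-monoˡ-≤ (qc a t) m≤a)

qc-≤-suc : PartialQuotients a → ∀ t → qc a t ≤ qc a (suc t)
qc-≤-suc {a} pa t = ℕ.≤-trans (ℕ.m≤n*m (qc a t) (a (suc t)) {{ℕ.>-nonZero (pa (suc t) (s≤s z≤n))}})
                              (ℕ.m≤m+n _ (qPrev a t))

qc-pos : PartialQuotients a → ∀ t → 1 ≤ qc a t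
qc-pos pa zero    = ℕ.≤-refl
qc-pos pa (suc t) = ℕ.≤-trans (qc-pos pa t) (qc-≤-suc pa t)

qc-mono : PartialQuotients a → ∀ {j k} → j ≤ k → qc a j ≤ qc a k
qc-mono {a} pa j≤k = go (ℕ.≤⇒≤′ j≤k)
  where
  go : ∀ {j k} → j ≤′ k → qc a j ≤ qc a k
  go ℕ.≤′-refl        = ℕ.≤-refl
  go (ℕ.≤′-step j≤k) = ℕ.≤-trans (go j≤k) (qc-≤-suc pa _)

qc-suc∸qc<qc-suc : PartialQuotients a → ∀ t → qc a (suc t) ∸ qc a t < qc a (suc t)
qc-suc∸qc<qc-suc pa t = ℕ.∸-monoʳ-< (qc-pos pa t) (qc-≤-suc pa t)

≢-qc-between : PartialQuotients a → qc a m < t → t < qc a (suc m) → ∀ j → t ≢ qc a j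
≢-qc-between {m = m} pa lo hi j refl with j ℕ.≤? m
... | yes j≤m = ℕ.<⇒≱ lo (qc-mono pa j≤m)
... | no  j≰m = ℕ.<⇒≱ hi (qc-mono pa (ℕ.≰⇒> j≰m))

n<m*n : ∀ {m n} → 2 ≤ m → 1 ≤ n → n < m * n
n<m*n {m} {n} 2≤m 1≤n = subst (n <_) (ℕ.*-comm n m) (ℕ.m<m*n n m {{ℕ.>-nonZero 1≤n}} 2≤m)

∣opposite-combination∣ : ∀ X Y A B → ∣ +[1+ X ] ℤ.* + A ℤ.- -[1+ Y ] ℤ.* + B ∣ ≡ suc X * A + suc Y * B
∣opposite-combination∣ X Y A B = cong ∣_∣ (begin
  +[1+ X ] ℤ.* + A ℤ.- -[1+ Y ] ℤ.* + B    ≡⟨ identity (+[1+ X ]) (+[1+ Y ]) (+ A) (+ B) ⟩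
  +[1+ X ] ℤ.* + A ℤ.+ +[1+ Y ] ℤ.* + B    ≡⟨ cong (ℤ._+_ (+[1+ X ] ℤ.* + A)) (ℤ.pos-* (suc Y) B) ⟨
  +[1+ X ] ℤ.* + A ℤ.+ + (suc Y * B)       ≡⟨ pos-*-+ (suc X) A (suc Y * B) ⟨
  + (suc X * A + suc Y * B)                ∎)
  where
  identity : ∀ x y a b → x ℤ.* a ℤ.- (ℤ.- y) ℤ.* b ≡ x ℤ.* a ℤ.+ y ℤ.* b
  identity = solve-∀

-- (x , y) are the coordinates of a candidate (p , q) in the basis (c_n , c_{n-1}) of convergents with
-- denominators Q and Q′, and A, B are the magnitudes of the errors of c_n and c_{n-1}.
module _ {A B Q Q′ q : ℕ} (1≤A : 1 ≤ A) (A<B : A < B)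
         (Q′<Q : Q′ < Q) (1≤q : 1 ≤ q) (q<Q+Q′ : q < Q + Q′) where

  private
    nonPositive : ∀ x y → x ℤ.≤ 0ℤ → y ℤ.≤ 0ℤ → x ℤ.* + Q ℤ.+ y ℤ.* + Q′ ≢ + q
    nonPositive x y x≤0 y≤0 eq = ℕ.<⇒≱ 1≤q (ℤ.drop‿+≤+ (subst (ℤ._≤ 0ℤ) eq
      (ℤ.+-mono-≤ (ℤ.*-monoʳ-≤-nonNeg (+ Q) x≤0) (ℤ.*-monoʳ-≤-nonNeg (+ Q′) y≤0))))

    positive : ∀ X Y → (X , Y) ≢ (0 , 0) → +[1+ X ] ℤ.* + Q ℤ.+ + Y ℤ.* + Q′ ≢ + q
    positive X Y ≢00 eq = ℕ.<⇒≱ q<Q+Q′ (subst (Q + Q′ ≤_) (ℤ.+-injective q≡) (Q+Q′≤ X Y ≢00))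
      where
      q≡ : + (suc X * Q + Y * Q′) ≡ + q
      q≡ = trans (trans (pos-*-+ (suc X) Q (Y * Q′)) (cong (ℤ._+_ (+[1+ X ] ℤ.* + Q)) (ℤ.pos-* Y Q′))) eq
      Q+Q′≤ : ∀ X Y → (X , Y) ≢ (0 , 0) → Q + Q′ ≤ suc X * Q + Y * Q′
      Q+Q′≤ zero    zero    ≢00 = ⊥-elim (≢00 refl)
      Q+Q′≤ (suc X) zero    _   = ℕ.≤-trans (ℕ.+-monoʳ-≤ Q (ℕ.≤-trans (ℕ.<⇒≤ Q′<Q) (ℕ.m≤m+n Q (X * Q))))
                                            (ℕ.m≤m+n _ 0)
      Q+Q′≤ X       (suc Y) _   = ℕ.+-mono-≤ (ℕ.m≤m+n Q (X * Q)) (ℕ.m≤m+n Q′ (Y * Q′))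

    minus-one-plus-one : -1ℤ ℤ.* + Q ℤ.+ 1ℤ ℤ.* + Q′ ≢ + q
    minus-one-plus-one eq = ℕ.<⇒≱ Q′<Q (ℕ.≤-trans (ℕ.m≤n+m Q q) (ℕ.≤-reflexive (ℤ.+-injective q+Q≡Q′)))
      where
      identity : ∀ Q Q′ → ((ℤ.- 1ℤ) ℤ.* Q ℤ.+ 1ℤ ℤ.* Q′) ℤ.+ Q ≡ Q′
      identity = solve-∀
      q+Q≡Q′ : + (q + Q) ≡ + Q′
      q+Q≡Q′ = trans (ℤ.pos-+ q Q) (trans (cong (ℤ._+ + Q) (sym eq)) (identity (+ Q) (+ Q′)))

    A+B≤ : ∀ X Y → A + B ≤ suc X * A + suc Y * B
    A+B≤ X Y = ℕ.+-mono-≤ (ℕ.m≤m+n A (X * A)) (ℕ.m≤m+n B (Y * B))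

    A+B< : ∀ X Y → (X , Y) ≢ (0 , 0) → A + B < suc X * A + suc Y * B
    A+B< zero    zero    ≢00 = ⊥-elim (≢00 refl)
    A+B< (suc X) Y       _   = ℕ.+-mono-<-≤ (n<m*n {m = suc (suc X)} (s≤s (s≤s z≤n)) 1≤A) (ℕ.m≤m+n B (Y * B))
    A+B< zero    (suc Y) _   =
      ℕ.+-mono-≤-< (ℕ.m≤m+n A 0) (n<m*n {m = suc (suc Y)} (s≤s (s≤s z≤n)) (ℕ.≤-trans 1≤A (ℕ.<⇒≤ A<B)))

    strictly : ∀ {V} {P : Set} → A + B < V → A + B ≤ V × (P → A + B < V)
    strictly A+B<V = ℕ.<⇒≤ A+B<V , λ _ → A+B<V

    ∣negated∣ : ∀ x y → ∣ (ℤ.- x) ℤ.* + A ℤ.- y ℤ.* + B ∣ ≡ ∣ x ℤ.* + A ℤ.- (ℤ.- y) ℤ.* + B ∣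
    ∣negated∣ x y = trans (cong ∣_∣ (identity x y (+ A) (+ B))) (ℤ.∣-i∣≡∣i∣ (x ℤ.* + A ℤ.- (ℤ.- y) ℤ.* + B))
      where
      identity : ∀ x y a b → (ℤ.- x) ℤ.* a ℤ.- y ℤ.* b ≡ ℤ.- (x ℤ.* a ℤ.- (ℤ.- y) ℤ.* b)
      identity = solve-∀

    ∣multiple-of-B∣ : ∀ y → ∣ 0ℤ ℤ.* + A ℤ.- + y ℤ.* + B ∣ ≡ y * B
    ∣multiple-of-B∣ y = begin
      ∣ 0ℤ ℤ.+ ℤ.- (+ y ℤ.* + B) ∣ ≡⟨ cong ∣_∣ (ℤ.+-identityˡ (ℤ.- (+ y ℤ.* + B))) ⟩
      ∣ ℤ.- (+ y ℤ.* + B) ∣        ≡⟨ ℤ.∣-i∣≡∣i∣ (+ y ℤ.* + B) ⟩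
      ∣ + y ℤ.* + B ∣              ≡⟨ cong ∣_∣ (ℤ.pos-* y B) ⟨
      y * B                        ∎

  combination-bound : ∀ x y → x ℤ.* + Q ℤ.+ y ℤ.* + Q′ ≡ + q → (x , y) ≢ (1ℤ , 0ℤ) → (x , y) ≢ (0ℤ , 1ℤ) →
                      A + B ≤ ∣ x ℤ.* + A ℤ.- y ℤ.* + B ∣ ×
                      ((x , y) ≢ (1ℤ , -1ℤ) → A + B < ∣ x ℤ.* + A ℤ.- y ℤ.* + B ∣)
  combination-bound (+ 0)     (+ 0)           eq _ _    = ⊥-elim (nonPositive 0ℤ 0ℤ ℤ.≤-refl ℤ.≤-refl eq)
  combination-bound (+ 0)     (+ 1)           _  _ ≢01  = ⊥-elim (≢01 refl)
  combination-bound (+ 0)     (+ suc (suc Y)) _  _ _    =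
    strictly (subst (A + B <_) (sym (∣multiple-of-B∣ (suc (suc Y)))) (ℕ.+-mono-<-≤ A<B (ℕ.m≤m+n B _)))
  combination-bound (+ 0)     -[1+ Y ]        eq _ _    = ⊥-elim (nonPositive 0ℤ -[1+ Y ] ℤ.≤-refl ℤ.-≤+ eq)
  combination-bound +[1+ X ]  (+ Y)           eq ≢10 _  = ⊥-elim (positive X Y (λ { refl → ≢10 refl }) eq)
  combination-bound +[1+ X ]  -[1+ Y ]        _  _ _    =
    subst (A + B ≤_) (sym value) (A+B≤ X Y) ,
    λ ≢1-1 → subst (A + B <_) (sym value) (A+B< X Y (λ { refl → ≢1-1 refl }))
    where value = ∣opposite-combination∣ X Y A B
  combination-bound -[1+ X ]  (+ 0)           eq _ _    = ⊥-elim (nonPositive -[1+ X ] 0ℤ ℤ.-≤+ ℤ.≤-refl eq)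
  combination-bound -[1+ X ]  +[1+ Y ]        eq _ _    =
    strictly (subst (A + B <_) (sym (trans (∣negated∣ +[1+ X ] +[1+ Y ]) (∣opposite-combination∣ X Y A B)))
                    (A+B< X Y (λ { refl → minus-one-plus-one eq })))
  combination-bound -[1+ X ]  -[1+ Y ]        eq _ _    = ⊥-elim (nonPositive -[1+ X ] -[1+ Y ] ℤ.-≤+ ℤ.-≤+ eq)

≡conv⇒IsConvergent : ∀ {p q} j → (p , + q) ≡ conv a j → IsConvergent a p q
≡conv⇒IsConvergent j eq = j , cong proj₁ eq , ℤ.+-injective (cong proj₂ eq)

qc<qc-suc : PartialQuotients a → 2 ≤ a (suc t) → qc a t < qc a (suc t)
qc<qc-suc {a} {t} pa 2≤a = ℕ.<-≤-trans (n<m*n {m = 2} ℕ.≤-refl (qc-pos pa t))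
                                       (ℕ.≤-trans (ℕ.m≤m+n _ (qPrev a t)) (qc-suc-≥ a t 2≤a))

difference-not-convergent : PartialQuotients a → ∀ m → 2 ≤ a (suc m) →
                            ¬ IsConvergent a (+ pc a (suc m) ℤ.- + pc a m) (qc a (suc m) ∸ qc a m)
-- For n = 1 the only smaller convergent is (p₀ , q₀) = (0 , 1), and p₁ - p₀ = 1.
difference-not-convergent {a} pa zero _ (zero , p≡ , _) =
  ℕ.m+1+n≢0 (a 1 * 0) (trans (sym (ℕ.+-identityʳ _)) (ℤ.+-injective p≡))
difference-not-convergent {a} pa zero _ (suc j , _ , q≡) =
  ℕ.<⇒≱ (qc-suc∸qc<qc-suc pa 0) (subst (qc a 1 ≤_) (sym q≡) (qc-mono pa (s≤s z≤n)))
difference-not-convergent {a} pa (suc m) 2≤a (j , _ , q≡) = ≢-qc-between pa above (qc-suc∸qc<qc-suc pa (suc m)) j q≡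
  where
  M : ℕ
  M = qc a (suc m)
  2x+1≡ : ∀ x → 2 * x + 1 ≡ suc x + x
  2x+1≡ = ℕ-solve-∀
  above : M < qc a (suc (suc m)) ∸ M
  above = ℕ.m+n≤o⇒m≤o∸n (suc M) (ℕ.≤-trans (ℕ.≤-reflexive (sym (2x+1≡ M)))
                                   (ℕ.≤-trans (ℕ.+-monoʳ-≤ (2 * M) (qc-pos pa m)) (qc-suc-≥ a (suc m) 2≤a)))

sum-not-convergent : PartialQuotients a → ∀ m → 2 ≤ a (suc (suc m)) →
                     ¬ IsConvergent a (+ pc a (suc m) ℤ.+ + pc a m) (qc a (suc m) + qc a m)
sum-not-convergent {a} pa m 2≤a (j , _ , q≡) = ≢-qc-between pa above below j q≡
  where
  above : qc a (suc m) < qc a (suc m) + qc a m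
  above = ℕ.m<m+n _ (qc-pos pa m)
  below : qc a (suc m) + qc a m < qc a (suc (suc m))
  below = ℕ.<-≤-trans (ℕ.+-monoˡ-< (qc a m) (n<m*n {m = 2} ℕ.≤-refl (qc-pos pa (suc m)))) (qc-suc-≥ a (suc m) 2≤a)

module Neighbours (a : ℕ → ℕ) (pa : PartialQuotients a) (m : ℕ)
                  (aₙ≥2 : 2 ≤ a (suc m)) (aₙ₊₁≥2 : 2 ≤ a (suc (suc m))) where

  n : ℕ
  n = suc m

  c c⁻ : ℤ²
  c  = conv a n
  c⁻ = conv a m   -- which conv⁻ a n reduces to

  inBasis : ℤ × ℤ → ℤ²
  inBasis (x , y) = x · c ⊕ y · c⁻

  q₋ q₊ : ℕ
  q₋ = qc a n ∸ qc a m
  q₊ = qc a n + qc a m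

  v₋ v₊ : ℤ²
  v₋ = + pc a n ℤ.- + pc a m , + q₋
  v₊ = + pc a n ℤ.+ + pc a m , + q₊

  qc-m<qc-n : qc a m < qc a n
  qc-m<qc-n = qc<qc-suc pa aₙ≥2

  1≤q₋ : 1 ≤ q₋
  1≤q₋ = ℕ.m<n⇒0<n∸m qc-m<qc-n

  q₋<q₊ : q₋ < q₊
  q₋<q₊ = ℕ.≤-<-trans (ℕ.m∸n≤m (qc a n) (qc a m)) (ℕ.m<m+n (qc a n) (qc-pos pa m))

  v₋≡ : v₋ ≡ inBasis (1ℤ , -1ℤ)
  v₋≡ = cong₂ _,_ (identity (+ pc a n) (+ pc a m)) (trans pos-q₋ (identity (+ qc a n) (+ qc a m)))
    where
    identity : ∀ u w → u ℤ.- w ≡ 1ℤ ℤ.* u ℤ.+ (ℤ.- 1ℤ) ℤ.* w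
    identity = solve-∀
    pos-q₋ : + q₋ ≡ + qc a n ℤ.- + qc a m
    pos-q₋ = trans (sym (ℤ.⊖-≥ (ℕ.<⇒≤ qc-m<qc-n))) (sym (ℤ.m-n≡m⊖n (qc a n) (qc a m)))

  v₊≡ : v₊ ≡ inBasis (1ℤ , 1ℤ)
  v₊≡ = cong₂ _,_ (identity (+ pc a n) (+ pc a m))
                  (trans (ℤ.pos-+ (qc a n) (qc a m)) (identity (+ qc a n) (+ qc a m)))
    where
    identity : ∀ u w → u ℤ.+ w ≡ 1ℤ ℤ.* u ℤ.+ 1ℤ ℤ.* w
    identity = solve-∀

  opposite : ∀ {k} → n < k → OppositeSigns (c⁻ ∧ conv a k) (c ∧ conv a k)
  opposite {k} n<k = OppositeSigns-step (a (suc n)) (ℕ.≤-trans (s≤s z≤n) aₙ₊₁≥2)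
                                        (conv-suc-∧ a n (conv a k)) (alternating pa (ℕ.≤⇒≤‴ n<k))

  A B : ∀ {k} → n < k → ℕ
  A n<k = OppositeSigns.∣j∣ (opposite n<k)
  B n<k = OppositeSigns.∣i∣ (opposite n<k)

  -- Unfolding OppositeSigns-step: A is ∣i∣ of the alternating pair at suc n, and B = a (suc n) * A + ∣j∣.
  1≤A : ∀ {k} (n<k : n < k) → 1 ≤ A n<k
  1≤A n<k = OppositeSigns.1≤∣i∣ (alternating pa (ℕ.≤⇒≤‴ n<k))

  A<B : ∀ {k} (n<k : n < k) → A n<k < B n<k
  A<B n<k = ℕ.<-≤-trans (n<m*n aₙ₊₁≥2 (1≤A n<k)) (ℕ.m≤m+n _ _)

  ∣inBasis∧conv∣ : ∀ {k} (n<k : n < k) x y →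
                   ∣ inBasis (x , y) ∧ conv a k ∣ ≡ ∣ x ℤ.* + A n<k ℤ.- y ℤ.* + B n<k ∣
  ∣inBasis∧conv∣ n<k = ∣combination∧∣≡ (opposite n<k)

  ∣v₋∧conv∣ : ∀ {k} (n<k : n < k) → ∣ v₋ ∧ conv a k ∣ ≡ A n<k + B n<k
  ∣v₋∧conv∣ {k} n<k = begin
    ∣ v₋ ∧ conv a k ∣                        ≡⟨ cong (λ v → ∣ v ∧ conv a k ∣) v₋≡ ⟩
    ∣ inBasis (1ℤ , -1ℤ) ∧ conv a k ∣        ≡⟨ ∣inBasis∧conv∣ n<k 1ℤ -1ℤ ⟩
    ∣ 1ℤ ℤ.* + A n<k ℤ.- -1ℤ ℤ.* + B n<k ∣   ≡⟨ ∣opposite-combination∣ 0 0 (A n<k) (B n<k) ⟩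
    1 * A n<k + 1 * B n<k                    ≡⟨ cong₂ _+_ (ℕ.*-identityˡ (A n<k)) (ℕ.*-identityˡ (B n<k)) ⟩
    A n<k + B n<k                            ∎

  ∣v₊∧conv∣<∣v₋∧conv∣ : ∀ {k} (n<k : n < k) → ∣ v₊ ∧ conv a k ∣ < ∣ v₋ ∧ conv a k ∣
  ∣v₊∧conv∣<∣v₋∧conv∣ {k} n<k =
    subst₂ _<_ (sym ∣v₊∧conv∣) (sym (∣v₋∧conv∣ n<k)) (ℕ.≤-<-trans (ℕ.m∸n≤m B′ A′) (ℕ.m<n+m B′ (1≤A n<k)))
    where
    A′ B′ : ℕ
    A′ = A n<k
    B′ = B n<k
    ∣v₊∧conv∣ : ∣ v₊ ∧ conv a k ∣ ≡ B′ ∸ A′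
    ∣v₊∧conv∣ = begin
      ∣ v₊ ∧ conv a k ∣                   ≡⟨ cong (λ v → ∣ v ∧ conv a k ∣) v₊≡ ⟩
      ∣ inBasis (1ℤ , 1ℤ) ∧ conv a k ∣    ≡⟨ ∣inBasis∧conv∣ n<k 1ℤ 1ℤ ⟩
      ∣ 1ℤ ℤ.* + A′ ℤ.- 1ℤ ℤ.* + B′ ∣     ≡⟨ cong₂ (λ s t → ∣ s ℤ.- t ∣)
                                                    (ℤ.*-identityˡ (+ A′)) (ℤ.*-identityˡ (+ B′)) ⟩
      ∣ + A′ ℤ.- + B′ ∣                   ≡⟨ cong ∣_∣ (ℤ.m-n≡m⊖n A′ B′) ⟩
      ∣ A′ ℤ.⊖ B′ ∣                       ≡⟨ ℤ.∣⊖∣-< (A<B n<k) ⟩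
      B′ ∸ A′                             ∎

  v₋-optimal : ∀ {k p q} → n < k → ¬ IsConvergent a p q → 1 ≤ q → q < q₊ →
               ∣ v₋ ∧ conv a k ∣ ≤ ∣ (p , + q) ∧ conv a k ∣ ×
               (q ≢ q₋ → ∣ v₋ ∧ conv a k ∣ < ∣ (p , + q) ∧ conv a k ∣)
  v₋-optimal {k} {p} {q} n<k ¬conv 1≤q q<q₊ =
    subst₂ _≤_ (sym (∣v₋∧conv∣ n<k)) (sym ∣v∧conv∣) (proj₁ bound) ,
    λ q≢q₋ → subst₂ _<_ (sym (∣v₋∧conv∣ n<k)) (sym ∣v∧conv∣) (proj₂ bound (q≢q₋ ∘ q≡q₋))
    where
    v : ℤ²
    v = p , + q
    x y : ℤ
    x = (c ∧ c⁻) ℤ.* (v ∧ c⁻)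
    y = (c ∧ c⁻) ℤ.* (c ∧ v)
    coordinates : inBasis (x , y) ≡ v
    coordinates = ∧-basis c c⁻ v (conv∧conv⁻-isSign a n)
    v≡inBasis : ∀ {xy} → (x , y) ≡ xy → v ≡ inBasis xy
    v≡inBasis xy≡ = trans (sym coordinates) (cong inBasis xy≡)
    ∣v∧conv∣ : ∣ v ∧ conv a k ∣ ≡ ∣ x ℤ.* + A n<k ℤ.- y ℤ.* + B n<k ∣
    ∣v∧conv∣ = trans (cong (λ w → ∣ w ∧ conv a k ∣) (sym coordinates)) (∣inBasis∧conv∣ n<k x y)
    q≡q₋ : (x , y) ≡ (1ℤ , -1ℤ) → q ≡ q₋
    q≡q₋ xy≡ = ℤ.+-injective (cong proj₂ (trans (v≡inBasis xy≡) (sym v₋≡)))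
    bound : A n<k + B n<k ≤ ∣ x ℤ.* + A n<k ℤ.- y ℤ.* + B n<k ∣ ×
            ((x , y) ≢ (1ℤ , -1ℤ) → A n<k + B n<k < ∣ x ℤ.* + A n<k ℤ.- y ℤ.* + B n<k ∣)
    bound = combination-bound (1≤A n<k) (A<B n<k) qc-m<qc-n 1≤q q<q₊ x y (cong proj₂ coordinates)
              (λ xy≡ → ¬conv (≡conv⇒IsConvergent n (trans (v≡inBasis xy≡) (1·u⊕0·w≡u c c⁻))))
              (λ xy≡ → ¬conv (≡conv⇒IsConvergent m (trans (v≡inBasis xy≡) (0·u⊕1·w≡w c c⁻))))

  v₋-not-convergent : ¬ IsConvergent a (proj₁ v₋) q₋
  v₋-not-convergent = difference-not-convergent pa m aₙ≥2

  v₋-closer : ∀ p′ q′ → 1 ≤ q′ → q′ < q₋ → ¬ IsConvergent a p′ q′ → Closer a (proj₁ v₋) q₋ p′ q′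
  v₋-closer p′ q′ 1≤q′ q′<q₋ ¬conv =
    suc n , λ k n<k → proj₂ (v₋-optimal n<k ¬conv 1≤q′ (ℕ.<-trans q′<q₋ q₋<q₊)) (ℕ.<⇒≢ q′<q₋)

  v₊-closer : ∀ p′ q′ → 1 ≤ q′ → q′ < q₊ → ¬ IsConvergent a p′ q′ → Closer a (proj₁ v₊) q₊ p′ q′
  v₊-closer p′ q′ 1≤q′ q′<q₊ ¬conv =
    suc n , λ k n<k → ℕ.<-≤-trans (∣v₊∧conv∣<∣v₋∧conv∣ n<k) (proj₁ (v₋-optimal n<k ¬conv 1≤q′ q′<q₊))

  q₋∈𝔔 : InQ a q₋
  q₋∈𝔔 with q₋ ℕ.≟ 1
  ... | yes q₋≡1 = inj₁ q₋≡1
  ... | no  q₋≢1 = inj₂ (ℕ.≤∧≢⇒< 1≤q₋ (q₋≢1 ∘ sym) , proj₁ v₋ , v₋-not-convergent , v₋-closer)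

  q₊∈𝔔 : InQ a q₊
  q₊∈𝔔 = inj₂ (ℕ.+-mono-≤ (qc-pos pa n) (qc-pos pa m) , proj₁ v₊ ,
                sum-not-convergent pa m aₙ₊₁≥2 , v₊-closer)

  nothing-between : ∀ t → InQ a t → q₋ < t → ¬ (t < q₊)
  nothing-between t (inj₁ refl) q₋<t _ = ℕ.<⇒≱ q₋<t 1≤q₋
  nothing-between t (inj₂ (2≤t , p , ¬conv , closer)) q₋<t t<q₊ =
    ℕ.<⇒≱ (proj₂ eventually-closer k (ℕ.m≤m+n K (suc n)))
          (proj₁ (v₋-optimal n<k ¬conv (ℕ.<⇒≤ 2≤t) t<q₊))
    where
    eventually-closer : Closer a p t (proj₁ v₋) q₋
    eventually-closer = closer (proj₁ v₋) q₋ 1≤q₋ q₋<t v₋-not-convergent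
    K k : ℕ
    K = proj₁ eventually-closer
    k = K + suc n
    n<k : n < k
    n<k = ℕ.m≤n+m (suc n) K

mainTheorem7 : (a : ℕ → ℕ) → PartialQuotients a →
    (n : ℕ) → 1 ≤ n → 2 ≤ a n → 2 ≤ a (suc n) →
    Successive a (qc a n ∸ qPrev a n) (qc a n + qPrev a n)
mainTheorem7 a pa (suc m) _ aₙ≥2 aₙ₊₁≥2 = q₋∈𝔔 , q₊∈𝔔 , q₋<q₊ , nothing-between
  where open Neighbours a pa m aₙ≥2 aₙ₊₁≥2
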